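{- Let $\mathsf{M}$ be a loopless matroid of rank $k$ on a ground set $E$ of size $n$, and let $\mathsf{U}_{k,n}$ denote the uniform matroid of rank $k$ on $E$. There is an injective map from the set of chains of flats $F_0\subsetneq\cdots\subsetneq F_m$ of $\mathsf{M}$ ($m\ge0$) to the set of chains of flats of $\mathsf{U}_{k,n}$, sending each chain $F_0\subsetneq\cdots\subsetneq F_m$ to a chain $G_0\subsetneq\cdots\subsetneq G_m$ with $\operatorname{rk}_{\mathsf{M}}(F_j)=\operatorname{rk}_{\mathsf{U}_{k,n}}(G_j)$ for each $j=0,\ldots,m$.
   Context: $\mathsf{U}_{k,n}$ on $E$ has as bases all $k$-subsets of $E$; its flats are the subsets of size less than $k$ together with $E$. -}

module Defs where

open import Data.Nat using (ℕ; suc; _≤_; _<_; _+_; _⊓_)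
open import Data.Fin using (Fin; inject₁) renaming (suc to fsuc)
open import Data.Fin.Subset using (Subset; _⊆_; _⊂_; _∪_; _∩_; ∣_∣; ⁅_⁆; _∉_; ⊤)
open import Data.Vec using (Vec; lookup)
open import Data.Product using (Σ; _×_)
open import Relation.Binary.PropositionalEquality using (_≡_)

record Matroid (n : ℕ) : Set where
  field
    rk        : Subset n → ℕ
    rk-bound  : ∀ X → rk X ≤ ∣ X ∣
    rk-mono   : ∀ {X Y} → X ⊆ Y → rk X ≤ rk Y
    rk-submod : ∀ X Y → rk (X ∪ Y) + rk (X ∩ Y) ≤ rk X + rk Y
open Matroid public

rank : ∀ {n} → Matroid n → ℕ
rank M = rk M ⊤

Loopless : ∀ {n} → Matroid n → Set
Loopless {n} M = ∀ (e : Fin n) → rk M ⁅ e ⁆ ≡ 1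

IsFlat : ∀ {n} → (Subset n → ℕ) → Subset n → Set
IsFlat {n} r X = ∀ (e : Fin n) → e ∉ X → r X < r (X ∪ ⁅ e ⁆)

rkU : ∀ {n} → ℕ → Subset n → ℕ
rkU k X = ∣ X ∣ ⊓ k

IsChainOfFlats : ∀ {n} → (Subset n → ℕ) → (m : ℕ) → Vec (Subset n) (suc m) → Set
IsChainOfFlats r m F =
  (∀ (j : Fin (suc m)) → IsFlat r (lookup F j)) ×
  (∀ (j : Fin m) → lookup F (inject₁ j) ⊂ lookup F (fsuc j))

ChainOfFlats : ∀ {n} → (Subset n → ℕ) → ℕ → Set
ChainOfFlats {n} r m = Σ (Vec (Subset n) (suc m)) (IsChainOfFlats r m)

-- Walking up the chain, extend a basis greedily to nested bases B₀ ⊆ ⋯ ⊆ B_m of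
-- F₀ ⊊ ⋯ ⊊ F_m, and send F_j to G_j = B_j if |B_j| < k and to E otherwise.  Each G_j is a
-- flat of U_{k,n} of rank min(|G_j|, k) = rk F_j; as these ranks strictly increase and
-- B_j ⊆ B_{j+1} gives G_j ⊆ G_{j+1}, the G_j form a chain.  Since G_j ⊆ F_j has the rank
-- of F_j, the flat F_j is the closure of G_j in M, so the chain is recovered from its image.
module Submission where

open import Defs
open import Data.Nat using (ℕ; suc; _≤_; _<_; _+_; _⊓_; s≤s; _≤?_; _<?_)
open import Data.Nat.Properties
open import Data.Fin using (Fin; inject₁) renaming (zero to fzero; suc to fsuc)
open import Data.Fin.Subset
  using (Subset; _⊆_; _⊂_; _∪_; _∩_; ∣_∣; ⁅_⁆; _∈_; ⊤; ⊥; inside; outside)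
open import Data.Fin.Subset.Properties
open import Data.Vec using (Vec; []; _∷_; lookup; map; here)
open import Data.Vec.Properties using (lookup-map)
open import Data.Vec.Relation.Binary.Pointwise.Extensional using (ext; Pointwise-≡⇒≡)
open import Data.List using (List; []; _∷_; filter; allFin)
open import Data.List.Membership.Propositional using () renaming (_∈_ to _∈ˡ_)
open import Data.List.Membership.Propositional.Properties using (∈-allFin; ∈-filter⁺)
open import Data.List.Relation.Unary.All as All using (All; []; _∷_)
open import Data.List.Relation.Unary.All.Properties using (all-filter)
open import Data.List.Relation.Unary.Any using () renaming (here to hereˡ; there to thereˡ)
open import Data.Product using (Σ; _×_; _,_; proj₁)
open import Data.Sum using (inj₁; inj₂)
open import Relation.Nullary using (Dec; yes; no; ¬_; contradiction)
open import Relation.Nullary.Decidable using (decidable-stable)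
open import Relation.Binary.PropositionalEquality
  using (_≡_; refl; sym; trans; cong; subst; subst₂)

private
  variable
    n m : ℕ
    e : Fin n
    p q s : Subset n

∪-least : p ⊆ s → q ⊆ s → p ∪ q ⊆ s
∪-least {p = p} {q = q} p⊆s q⊆s x∈p∪q with x∈p∪q⁻ p q x∈p∪q
... | inj₁ x∈p = p⊆s x∈p
... | inj₂ x∈q = q⊆s x∈q

∩-greatest : s ⊆ p → s ⊆ q → s ⊆ p ∩ q
∩-greatest s⊆p s⊆q x∈s = x∈p∩q⁺ (s⊆p x∈s , s⊆q x∈s)

x∈p⇒⁅x⁆⊆p : e ∈ p → ⁅ e ⁆ ⊆ p
x∈p⇒⁅x⁆⊆p {e = e} e∈p x∈⁅e⁆ with x∈⁅y⁆⇒x≡y e x∈⁅e⁆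
... | refl = e∈p

∣p∪⁅x⁆∣≤1+∣p∣ : ∀ (p : Subset n) x → ∣ p ∪ ⁅ x ⁆ ∣ ≤ suc ∣ p ∣
∣p∪⁅x⁆∣≤1+∣p∣ (outside ∷ p) fzero    = s≤s (≤-reflexive (cong ∣_∣ (∪-identityʳ p)))
∣p∪⁅x⁆∣≤1+∣p∣ (inside  ∷ p) fzero    =
  s≤s (≤-trans (≤-reflexive (cong ∣_∣ (∪-identityʳ p))) (n≤1+n _))
∣p∪⁅x⁆∣≤1+∣p∣ (outside ∷ p) (fsuc x) = ∣p∪⁅x⁆∣≤1+∣p∣ p x
∣p∪⁅x⁆∣≤1+∣p∣ (inside  ∷ p) (fsuc x) = s≤s (∣p∪⁅x⁆∣≤1+∣p∣ p x)

p⊆q∧∣p∣<∣q∣⇒p⊂q : p ⊆ q → ∣ p ∣ < ∣ q ∣ → p ⊂ q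
p⊆q∧∣p∣<∣q∣⇒p⊂q {p = []}          {[]}          _   ()
p⊆q∧∣p∣<∣q∣⇒p⊂q {p = outside ∷ p} {outside ∷ q} p⊆q ∣p∣<∣q∣ =
  s⊂s (p⊆q∧∣p∣<∣q∣⇒p⊂q (drop-∷-⊆ p⊆q) ∣p∣<∣q∣)
p⊆q∧∣p∣<∣q∣⇒p⊂q {p = outside ∷ p} {inside  ∷ q} p⊆q _ = out⊂in (drop-∷-⊆ p⊆q)
p⊆q∧∣p∣<∣q∣⇒p⊂q {p = inside  ∷ p} {outside ∷ q} p⊆q _ with () ← p⊆q here
p⊆q∧∣p∣<∣q∣⇒p⊂q {p = inside  ∷ p} {inside  ∷ q} p⊆q (s≤s ∣p∣<∣q∣) =
  s⊂s (p⊆q∧∣p∣<∣q∣⇒p⊂q (drop-∷-⊆ p⊆q) ∣p∣<∣q∣)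

elements : Subset n → List (Fin n)
elements p = filter (_∈? p) (allFin _)

∈-elements : e ∈ p → e ∈ˡ elements p
∈-elements {e = e} e∈p = ∈-filter⁺ (_∈? _) (∈-allFin e) e∈p

rkU-flat-⊤ : ∀ k → IsFlat (rkU {n} k) ⊤
rkU-flat-⊤ k e e∉⊤ = contradiction ∈⊤ e∉⊤

rkU-flat-small : ∀ k {X : Subset n} → ∣ X ∣ < k → IsFlat (rkU k) X
rkU-flat-small k {X} ∣X∣<k e e∉X = begin-strict
  ∣ X ∣ ⊓ k          ≡⟨ m≤n⇒m⊓n≡m (<⇒≤ ∣X∣<k) ⟩
  ∣ X ∣              <⟨ ⊓-glb (p⊂q⇒∣p∣<∣q∣ X⊂X∪e) ∣X∣<k ⟩
  ∣ X ∪ ⁅ e ⁆ ∣ ⊓ k  ∎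
  where
  open ≤-Reasoning
  X⊂X∪e : X ⊂ X ∪ ⁅ e ⁆
  X⊂X∪e = p⊆p∪q ⁅ e ⁆ , e , q⊆p∪q X ⁅ e ⁆ (x∈⁅x⁆ e) , e∉X

⊆∧rkU<⇒⊂ : ∀ k {X Y : Subset n} → X ⊆ Y → rkU k X < rkU k Y → X ⊂ Y
⊆∧rkU<⇒⊂ k X⊆Y rkX<rkY =
  p⊆q∧∣p∣<∣q∣⇒p⊂q X⊆Y (≰⇒> (λ ∣Y∣≤∣X∣ → <⇒≱ rkX<rkY (⊓-monoˡ-≤ k ∣Y∣≤∣X∣)))

uniformFlat : ℕ → Subset n → Subset n
uniformFlat k B with ∣ B ∣ <? k
... | yes _ = B
... | no  _ = ⊤

uniformFlat-isFlat : ∀ k (B : Subset n) → IsFlat (rkU k) (uniformFlat k B)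
uniformFlat-isFlat k B with ∣ B ∣ <? k
... | yes ∣B∣<k = rkU-flat-small k ∣B∣<k
... | no  _     = rkU-flat-⊤ k

uniformFlat-mono : ∀ k {B B′ : Subset n} → B ⊆ B′ → uniformFlat k B ⊆ uniformFlat k B′
uniformFlat-mono k {B} {B′} B⊆B′ with ∣ B ∣ <? k | ∣ B′ ∣ <? k
... | _        | no _       = ⊆⊤
... | yes _    | yes _      = B⊆B′
... | no ∣B∣≮k | yes ∣B′∣<k = contradiction (≤-<-trans (p⊆q⇒∣p∣≤∣q∣ B⊆B′) ∣B′∣<k) ∣B∣≮k

module MatroidProperties (M : Matroid n) where

  r : Subset n → ℕ
  r = rk M

  rk≤rank : ∀ X → r X ≤ rank M
  rk≤rank X = rk-mono M ⊆⊤

  Independent : Subset n → Set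
  Independent X = ∣ X ∣ ≡ r X

  independent-⊥ : Independent ⊥
  independent-⊥ = trans (∣⊥∣≡0 n) (sym (n≤0⇒n≡0 (subst (r ⊥ ≤_) (∣⊥∣≡0 n) (rk-bound M ⊥))))

  _∈span_ : Fin n → Subset n → Set
  e ∈span S = r (S ∪ ⁅ e ⁆) ≤ r S

  _∈span?_ : ∀ e S → Dec (e ∈span S)
  e ∈span? S = r (S ∪ ⁅ e ⁆) ≤? r S

  ∈span-mono : ∀ {S T} → S ⊆ T → e ∈span S → e ∈span T
  ∈span-mono {e = e} {S} {T} S⊆T e∈spanS = +-cancelʳ-≤ (r S) _ _ (begin
    r (T ∪ ⁅ e ⁆) + r S                      ≤⟨ +-mono-≤ (rk-mono M T∪e⊆) (rk-mono M S⊆∩) ⟩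
    r ((S ∪ ⁅ e ⁆) ∪ T) + r ((S ∪ ⁅ e ⁆) ∩ T) ≤⟨ rk-submod M (S ∪ ⁅ e ⁆) T ⟩
    r (S ∪ ⁅ e ⁆) + r T                      ≤⟨ +-monoˡ-≤ (r T) e∈spanS ⟩
    r S + r T                                ≡⟨ +-comm (r S) (r T) ⟩
    r T + r S                                ∎)
    where
    open ≤-Reasoning
    T∪e⊆ : T ∪ ⁅ e ⁆ ⊆ (S ∪ ⁅ e ⁆) ∪ T
    T∪e⊆ = ∪-least (q⊆p∪q _ T) (⊆-trans (q⊆p∪q S ⁅ e ⁆) (p⊆p∪q T))
    S⊆∩ : S ⊆ (S ∪ ⁅ e ⁆) ∩ T
    S⊆∩ = ∩-greatest (p⊆p∪q ⁅ e ⁆) S⊆T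

  ∈span-flat⇒∈ : ∀ {F} → IsFlat r F → e ∈span F → e ∈ F
  ∈span-flat⇒∈ {e = e} {F} flat e∈spanF =
    decidable-stable (e ∈? F) (λ e∉F → <⇒≱ (flat e e∉F) e∈spanF)

  ∈⇒∈span : ∀ {S} → e ∈ S → e ∈span S
  ∈⇒∈span e∈S = rk-mono M (∪-least ⊆-refl (x∈p⇒⁅x⁆⊆p e∈S))

  _spans_ : Subset n → Subset n → Set
  G spans F = G ⊆ F × r F ≤ r G

  spans⇒∈span : ∀ {G F} → G spans F → e ∈ F → e ∈span G
  spans⇒∈span (G⊆F , rF≤rG) e∈F = ≤-trans (rk-mono M (∪-least G⊆F (x∈p⇒⁅x⁆⊆p e∈F))) rF≤rG

  spans-⊆-flat : ∀ {G F F′} → IsFlat r F′ → G ⊆ F′ → G spans F → F ⊆ F′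
  spans-⊆-flat flat G⊆F′ Gspans e∈F = ∈span-flat⇒∈ flat (∈span-mono G⊆F′ (spans⇒∈span Gspans e∈F))

  flat-unique : ∀ {G F F′} → IsFlat r F → IsFlat r F′ → G spans F → G spans F′ → F ≡ F′
  flat-unique flat flat′ Gspans Gspans′ =
    ⊆-antisym (spans-⊆-flat flat′ (proj₁ Gspans′) Gspans) (spans-⊆-flat flat (proj₁ Gspans) Gspans′)

  flat-of-full-rank : ∀ {F} → IsFlat r F → rank M ≤ r F → F ≡ ⊤
  flat-of-full-rank flat full =
    ⊆-antisym ⊆⊤ (λ {e} _ → ∈span-flat⇒∈ flat (≤-trans (rk≤rank _) full))

  flat-⊂⇒rk< : ∀ {F F′} → IsFlat r F → F ⊂ F′ → r F < r F′
  flat-⊂⇒rk< flat (F⊆F′ , e , e∈F′ , e∉F) =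
    ≤-trans (flat e e∉F) (rk-mono M (∪-least F⊆F′ (x∈p⇒⁅x⁆⊆p e∈F′)))

  insertAll : List (Fin n) → Subset n → Subset n
  insertAll []       S = S
  insertAll (e ∷ es) S = insertAll es S ∪ ⁅ e ⁆

  ⊆-insertAll : ∀ es {S} → S ⊆ insertAll es S
  ⊆-insertAll []       x∈S = x∈S
  ⊆-insertAll (e ∷ es) x∈S = p⊆p∪q ⁅ e ⁆ (⊆-insertAll es x∈S)

  ∈-insertAll : ∀ {es S} → e ∈ˡ es → e ∈ insertAll es S
  ∈-insertAll {es = e ∷ es} (hereˡ refl) = q⊆p∪q _ ⁅ e ⁆ (x∈⁅x⁆ e)
  ∈-insertAll {es = e ∷ es} (thereˡ e′∈es) = p⊆p∪q ⁅ e ⁆ (∈-insertAll e′∈es)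

  rk-insertAll : ∀ {es B} → All (_∈span B) es → r (insertAll es B) ≤ r B
  rk-insertAll [] = ≤-refl
  rk-insertAll {es = e ∷ es} (e∈spanB ∷ es∈spanB) =
    ≤-trans (∈span-mono (⊆-insertAll es) e∈spanB) (rk-insertAll es∈spanB)

  rk≤-of-⊆span : ∀ {X B} → (∀ {e} → e ∈ X → e ∈span B) → r X ≤ r B
  rk≤-of-⊆span {X} {B} X⊆span = ≤-trans
    (rk-mono M (λ e∈X → ∈-insertAll (∈-elements e∈X)))
    (rk-insertAll (All.map X⊆span (all-filter (_∈? X) (allFin n))))

  grow : List (Fin n) → Subset n → Subset n
  grow []       S = S
  grow (e ∷ es) S with e ∈span? S
  ... | yes _ = grow es S
  ... | no  _ = grow es (S ∪ ⁅ e ⁆)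

  ⊆-grow : ∀ es {S} → S ⊆ grow es S
  ⊆-grow []       x∈S = x∈S
  ⊆-grow (e ∷ es) {S} x∈S with e ∈span? S
  ... | yes _ = ⊆-grow es x∈S
  ... | no  _ = ⊆-grow es (p⊆p∪q ⁅ e ⁆ x∈S)

  grow-⊆ : ∀ {es S F} → All (_∈ F) es → S ⊆ F → grow es S ⊆ F
  grow-⊆ [] S⊆F = S⊆F
  grow-⊆ {es = e ∷ _} {S} (e∈F ∷ es⊆F) S⊆F with e ∈span? S
  ... | yes _ = grow-⊆ es⊆F S⊆F
  ... | no  _ = grow-⊆ es⊆F (∪-least S⊆F (x∈p⇒⁅x⁆⊆p e∈F))

  independent-∪⁅⁆ : ∀ {S} → Independent S → ¬ e ∈span S → Independent (S ∪ ⁅ e ⁆)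
  independent-∪⁅⁆ {e = e} {S} indep e∉spanS = ≤-antisym (begin
    ∣ S ∪ ⁅ e ⁆ ∣  ≤⟨ ∣p∪⁅x⁆∣≤1+∣p∣ S e ⟩
    suc ∣ S ∣      ≡⟨ cong suc indep ⟩
    suc (r S)      ≤⟨ ≰⇒> e∉spanS ⟩
    r (S ∪ ⁅ e ⁆)  ∎) (rk-bound M _)
    where open ≤-Reasoning

  grow-independent : ∀ es {S} → Independent S → Independent (grow es S)
  grow-independent []       indep = indep
  grow-independent (e ∷ es) {S} indep with e ∈span? S
  ... | yes _       = grow-independent es indep
  ... | no  e∉spanS = grow-independent es (independent-∪⁅⁆ indep e∉spanS)

  grow-∈span : ∀ {es S} → e ∈ˡ es → e ∈span grow es S
  grow-∈span {es = e ∷ es} {S} (hereˡ refl) with e ∈span? S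
  ... | yes e∈spanS = ∈span-mono (⊆-grow es) e∈spanS
  ... | no  _       = ∈span-mono (⊆-grow es) (∈⇒∈span (q⊆p∪q S ⁅ e ⁆ (x∈⁅x⁆ e)))
  grow-∈span {es = e′ ∷ es} {S} (thereˡ e∈es) with e′ ∈span? S
  ... | yes _ = grow-∈span e∈es
  ... | no  _ = grow-∈span e∈es

  record IsBasisOf (F B : Subset n) : Set where
    field
      basis-⊆           : B ⊆ F
      basis-independent : Independent B
      basis-rk          : r B ≡ r F

    ∣basis∣≡rk : ∣ B ∣ ≡ r F
    ∣basis∣≡rk = trans basis-independent basis-rk

  open IsBasisOf public

  extendToBasis : Subset n → Subset n → Subset n
  extendToBasis F I = grow (elements F) I

  extendToBasis-isBasis : ∀ {F I} → I ⊆ F → Independent I → IsBasisOf F (extendToBasis F I)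
  extendToBasis-isBasis {F} {I} I⊆F indep = record
    { basis-⊆           = B⊆F
    ; basis-independent = grow-independent (elements F) indep
    ; basis-rk          = ≤-antisym (rk-mono M B⊆F)
                            (rk≤-of-⊆span (λ e∈F → grow-∈span (∈-elements e∈F)))
    }
    where
    B⊆F : extendToBasis F I ⊆ F
    B⊆F = grow-⊆ (all-filter (_∈? F) (allFin n)) I⊆F

  Nested : Vec (Subset n) (suc m) → Set
  Nested {m} Xs = ∀ (j : Fin m) → lookup Xs (inject₁ j) ⊆ lookup Xs (fsuc j)

  nestedBases : Subset n → Vec (Subset n) m → Vec (Subset n) m
  nestedBases I []       = []
  nestedBases I (F ∷ Fs) = extendToBasis F I ∷ nestedBases (extendToBasis F I) Fs

  nestedBases-isBasis : ∀ {I} (Fs : Vec (Subset n) (suc m)) → I ⊆ lookup Fs fzero →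
    Independent I → Nested Fs → ∀ j → IsBasisOf (lookup Fs j) (lookup (nestedBases I Fs) j)
  nestedBases-isBasis (F ∷ Fs) I⊆F indep nested fzero = extendToBasis-isBasis I⊆F indep
  nestedBases-isBasis {m = suc _} (F ∷ Fs) I⊆F indep nested (fsuc j) =
    nestedBases-isBasis Fs (⊆-trans (basis-⊆ B) (nested fzero)) (basis-independent B)
      (λ j → nested (fsuc j)) j
    where B = extendToBasis-isBasis I⊆F indep

  nestedBases-nested : ∀ I (Fs : Vec (Subset n) (suc m)) → Nested (nestedBases I Fs)
  nestedBases-nested I (F ∷ F′ ∷ Fs) fzero    = ⊆-grow (elements F′)
  nestedBases-nested I (F ∷ F′ ∷ Fs) (fsuc j) = nestedBases-nested (extendToBasis F I) (F′ ∷ Fs) j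

  rank≤rk-of-large-basis : ∀ {F B} → IsBasisOf F B → ¬ ∣ B ∣ < rank M → rank M ≤ r F
  rank≤rk-of-large-basis basis ∣B∣≮k = subst (rank M ≤_) (∣basis∣≡rk basis) (≮⇒≥ ∣B∣≮k)

  uniformFlat-spans : ∀ {F B} → IsFlat r F → IsBasisOf F B → uniformFlat (rank M) B spans F
  uniformFlat-spans {F} {B} flat basis with ∣ B ∣ <? rank M
  ... | yes _     = basis-⊆ basis , ≤-reflexive (sym (basis-rk basis))
  ... | no ∣B∣≮k = ⊆-reflexive (sym F≡⊤) , rk-mono M ⊆⊤
    where
    F≡⊤ : F ≡ ⊤
    F≡⊤ = flat-of-full-rank flat (rank≤rk-of-large-basis basis ∣B∣≮k)

  rk-uniformFlat : ∀ {F B} → IsBasisOf F B → r F ≡ rkU (rank M) (uniformFlat (rank M) B)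
  rk-uniformFlat {F} {B} basis with ∣ B ∣ <? rank M
  ... | yes ∣B∣<k = trans (sym (∣basis∣≡rk basis)) (sym (m≤n⇒m⊓n≡m (<⇒≤ ∣B∣<k)))
  ... | no ∣B∣≮k = trans (≤-antisym (rk≤rank F) (rank≤rk-of-large-basis basis ∣B∣≮k))
                         (sym (m≥n⇒m⊓n≡n (rk-bound M ⊤)))

module ChainImage (M : Matroid n) where
  open MatroidProperties M

  bases : ChainOfFlats r m → Vec (Subset n) (suc m)
  bases (Fs , _) = nestedBases ⊥ Fs

  bases-isBasis : (c : ChainOfFlats r m) → ∀ j → IsBasisOf (lookup (proj₁ c) j) (lookup (bases c) j)
  bases-isBasis (Fs , _ , strict) = nestedBases-isBasis Fs ⊥⊆ independent-⊥ (λ j → proj₁ (strict j))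

  image : ChainOfFlats r m → Vec (Subset n) (suc m)
  image c = map (uniformFlat (rank M)) (bases c)

  lookup-image : ∀ (c : ChainOfFlats r m) j →
    lookup (image c) j ≡ uniformFlat (rank M) (lookup (bases c) j)
  lookup-image c j = lookup-map j (uniformFlat (rank M)) (bases c)

  rk-image : ∀ (c : ChainOfFlats r m) j → r (lookup (proj₁ c) j) ≡ rkU (rank M) (lookup (image c) j)
  rk-image c j =
    trans (rk-uniformFlat (bases-isBasis c j)) (cong (rkU (rank M)) (sym (lookup-image c j)))

  image-spans : ∀ (c : ChainOfFlats r m) j → lookup (image c) j spans lookup (proj₁ c) j
  image-spans c@(_ , flat , _) j =
    subst (_spans _) (sym (lookup-image c j)) (uniformFlat-spans (flat j) (bases-isBasis c j))

  image-nested : ∀ (c : ChainOfFlats r m) → Nested (image c)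
  image-nested c@(Fs , _) j =
    subst₂ _⊆_ (sym (lookup-image c (inject₁ j))) (sym (lookup-image c (fsuc j)))
      (uniformFlat-mono (rank M) (nestedBases-nested ⊥ Fs j))

  image-isChain : ∀ (c : ChainOfFlats r m) → IsChainOfFlats (rkU (rank M)) m (image c)
  image-isChain c@(_ , flat , strict) = image-flat , image-strict
    where
    image-flat : ∀ j → IsFlat (rkU (rank M)) (lookup (image c) j)
    image-flat j = subst (IsFlat (rkU (rank M))) (sym (lookup-image c j)) (uniformFlat-isFlat (rank M) _)
    image-strict : ∀ j → lookup (image c) (inject₁ j) ⊂ lookup (image c) (fsuc j)
    image-strict j = ⊆∧rkU<⇒⊂ (rank M) (image-nested c j)
      (subst₂ _<_ (rk-image c (inject₁ j)) (rk-image c (fsuc j))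
        (flat-⊂⇒rk< (flat (inject₁ j)) (strict j)))

  image-injective : ∀ (c c′ : ChainOfFlats r m) → image c ≡ image c′ → proj₁ c ≡ proj₁ c′
  image-injective c@(_ , flat , _) c′@(_ , flat′ , _) image≡ = Pointwise-≡⇒≡ (ext λ j →
    flat-unique (flat j) (flat′ j) (image-spans c j)
      (subst (_spans _) (cong (λ v → lookup v j) (sym image≡)) (image-spans c′ j)))

lemma3p36 : ∀ (n k : ℕ) (M : Matroid n) → Loopless M → rank M ≡ k →
    Σ (∀ (m : ℕ) → ChainOfFlats (rk M) m → ChainOfFlats (rkU {n} k) m) λ f →
      (∀ (m : ℕ) (c c′ : ChainOfFlats (rk M) m) →
        proj₁ (f m c) ≡ proj₁ (f m c′) → proj₁ c ≡ proj₁ c′)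
      × (∀ (m : ℕ) (c : ChainOfFlats (rk M) m) (j : Fin (suc m)) →
        rk M (lookup (proj₁ c) j) ≡ rkU k (lookup (proj₁ (f m c)) j))
lemma3p36 n .(rank M) M _ refl =
  (λ m c → image c , image-isChain c) , (λ m → image-injective) , (λ m → rk-image)
  where open ChainImage M
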